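{- Let $G$ be a connected subcubic graph with $i(G)=3\rho(G)$, let $S$ be any maximal packing of $G$, let $A\subseteq N$ satisfy conditions (i)–(iii) below, let $Z$ be an independent dominating set of $G[T]$, let $\hat A=A\cup S^A\cup Z$, and let $f:\hat A\to N\cup S^A_1\cup S^A_2$ be an injective function such that $f(v)=v$ for $v\in A\cup S^A_1\cup S^A_2$, and for $v\in S^A_3\cup Z$, $f(v)$ is a neighbor of $v$, where moreover $f(v)$ has two neighbors in $N$ whenever $v\in S^A_3$ (such a function exists). Then: (a) $S_1=\emptyset$ and $S_2=S^A_2$; (b) $f$ is a bijection from $\hat A=A\cup S^A_2\cup S^A_3\cup Z$ onto $N\cup S^A_2$; (c) if $x\in N\setminus A$ and $d_H(x)=1$, then $x\in W$.
   Context: All graphs are finite, simple, undirected; subcubic means maximum degree at most $3$. $i(G)$ is the minimum size of an independent dominating set; a packing is a vertex set with pairwise distances at least $3$, maximal if not properly contained in another packing; $\rho(G)$ is the maximum packing size. Given the maximal packing $S$: $N=N_G(S)$ (open neighborhood of $S$), $R=V(G)\setminus (S\cup N)$, $H=G[N]$ (which has maximum degree at most $2$, so is a disjoint union of paths, cycles and isolated vertices). $M$ is the set of components of $H$ that are paths with exactly one edge, and $W$ is the set of endpoints of the edges in $M$. $S_i$ is the set of vertices of $S$ of degree $i$ in $G$ ($i=1,2,3$). For $B\subseteq N$, $X(B)$ is the set of all $s\in S$ with $|N_G(s)|=3$ and $N_G(s)\subseteq (N\setminus B)\cap W$. The set $A\subseteq N$ satisfies: (i) for each path component of $H$ with at least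 $2$ edges, $A$ contains both endpoints of that path; (ii) $A$ is a maximal independent set of $H$ satisfying (i); (iii) $|X(A)|$ is minimum among all sets satisfying (i) and (ii). $S^A$ is the set of vertices of $S$ having no neighbor in $A$, and $S^A_i=S^A\cap S_i$. $T$ is the set of vertices of $R$ having no neighbor in $A$. $d_H(x)$ is the degree of $x$ in $H$. -}

module Defs where

open import Data.Nat using (ℕ; zero; suc; _≤_)
open import Data.Fin using (Fin; zero; suc; toℕ; fromℕ)
open import Data.Fin.Subset using (Subset; _∈_; _∉_; _⊆_; ∣_∣)
open import Data.Bool using (Bool; true; false)
open import Data.Product using (Σ; ∃; ∃-syntax; _×_; _,_)
open import Data.Sum using (_⊎_)
open import Relation.Nullary using (¬_)
open import Relation.Binary.PropositionalEquality using (_≡_; _≢_)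
open import Function.Bundles using (_⇔_)

record Graph (n : ℕ) : Set where
  field
    adj    : Fin n → Fin n → Bool
    sym    : ∀ u v → adj u v ≡ adj v u
    irrefl : ∀ v → adj v v ≡ false

open Graph public

VSet : ℕ → Set₁
VSet n = Fin n → Set

Card : ∀ {n} → VSet n → ℕ → Set
Card {n} P k = Σ (Subset n) λ D → (∀ y → (y ∈ D) ⇔ P y) × ∣ D ∣ ≡ k

module _ {n : ℕ} (G : Graph n) where

  Adj : Fin n → Fin n → Set
  Adj u v = adj G u v ≡ true

  Deg : Fin n → ℕ → Set
  Deg v k = Card (Adj v) k

  Subcubic : Set
  Subcubic = ∀ v k → Deg v k → k ≤ 3

  data Reach : Fin n → Fin n → Set where
    here : ∀ {v} → Reach v v
    step : ∀ {u w v} → Adj u w → Reach w v → Reach u v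

  Connected : Set
  Connected = ∀ u v → Reach u v

  Independent : Subset n → Set
  Independent D = ∀ u v → u ∈ D → v ∈ D → adj G u v ≡ false

  Dominating : Subset n → Set
  Dominating D = ∀ v → v ∈ D ⊎ (∃[ u ] (u ∈ D × Adj u v))

  IndepDominating : Subset n → Set
  IndepDominating D = Independent D × Dominating D

  IndepDomNumber : ℕ → Set
  IndepDomNumber k =
    (∃[ D ] (IndepDominating D × ∣ D ∣ ≡ k)) ×
    (∀ D → IndepDominating D → k ≤ ∣ D ∣)

  -- packing: distinct vertices are at distance at least 3, i.e. they are
  -- neither adjacent nor have a common neighbour
  Packing : Subset n → Set
  Packing D = ∀ u v → u ∈ D → v ∈ D → u ≢ v →
    ¬ Adj u v × (∀ w → ¬ (Adj u w × Adj w v))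

  MaximalPacking : Subset n → Set
  MaximalPacking D = Packing D × (∀ D′ → Packing D′ → D ⊆ D′ → D′ ⊆ D)

  PackingNumber : ℕ → Set
  PackingNumber k =
    (∃[ D ] (Packing D × ∣ D ∣ ≡ k)) × (∀ D → Packing D → ∣ D ∣ ≤ k)

  module _ (S : Subset n) where

    InN : VSet n
    InN v = ∃[ s ] (s ∈ S × Adj s v)

    InR : VSet n
    InR v = v ∉ S × ¬ InN v

    -- adjacency in H = G[N]
    AdjH : Fin n → Fin n → Set
    AdjH u v = InN u × InN v × Adj u v

    DegH : Fin n → ℕ → Set
    DegH x k = Card (AdjH x) k

    data ReachH : Fin n → Fin n → Set where
      here : ∀ {v} → ReachH v v
      step : ∀ {u w v} → AdjH u w → ReachH w v → ReachH u v

    -- The component of H containing x is a path with exactly k edges,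
    -- whose endpoints are x and y: there is a sequence of distinct
    -- vertices x = v₀, …, v_k = y of N whose set is the whole component
    -- of x in H and such that the edges of H among them are exactly the
    -- consecutive pairs.
    record PathComponent (x y : Fin n) (k : ℕ) : Set where
      field
        vs       : Fin (suc k) → Fin n
        distinct : ∀ i j → vs i ≡ vs j → i ≡ j
        inN      : ∀ i → InN (vs i)
        start    : vs zero ≡ x
        end      : vs (fromℕ k) ≡ y
        edges    : ∀ i j → AdjH (vs i) (vs j) ⇔
                     (toℕ i ≡ suc (toℕ j) ⊎ toℕ j ≡ suc (toℕ i))
        covers   : ∀ z → ReachH x z → ∃[ i ] (vs i ≡ z)

    -- W: endpoints of the edges of M (components of H that are paths
    -- with exactly one edge)
    InW : VSet n
    InW w = ∃[ y ] PathComponent w y 1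

    CondI : Subset n → Set
    CondI B = ∀ x y k → 2 ≤ k → PathComponent x y k → x ∈ B × y ∈ B

    IndepH : Subset n → Set
    IndepH B = (∀ v → v ∈ B → InN v) × Independent B

    CondII : Subset n → Set
    CondII B = CondI B × IndepH B ×
      (∀ B′ → IndepH B′ → CondI B′ → B ⊆ B′ → B′ ⊆ B)

    InX : Subset n → VSet n
    InX B s = s ∈ S × Deg s 3 × (∀ y → Adj s y → y ∉ B × InW y)

    CondIII : Subset n → Set
    CondIII B = CondII B ×
      (∀ B′ → CondII B′ → ∀ a b → Card (InX B) a → Card (InX B′) b → a ≤ b)

    InSi : ℕ → VSet n
    InSi i s = s ∈ S × Deg s i

    module _ (A : Subset n) where

      InSA : VSet n
      InSA s = s ∈ S × (∀ a → a ∈ A → ¬ Adj s a)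

      InSAi : ℕ → VSet n
      InSAi i s = InSA s × Deg s i

      InT : VSet n
      InT v = InR v × (∀ a → a ∈ A → ¬ Adj v a)

      IndepDomT : Subset n → Set
      IndepDomT Z = (∀ v → v ∈ Z → InT v) × Independent Z ×
        (∀ t → InT t → t ∈ Z ⊎ ∃[ z ] (z ∈ Z × Adj z t))

      module _ (Z : Subset n) where

        InÂ : VSet n
        InÂ v = v ∈ A ⊎ InSA v ⊎ v ∈ Z

        GoodF : (Fin n → Fin n) → Set
        GoodF f =
          (∀ v → InÂ v → InN (f v) ⊎ InSAi 1 (f v) ⊎ InSAi 2 (f v)) ×
          (∀ u v → InÂ u → InÂ v → f u ≡ f v → u ≡ v) ×
          (∀ v → v ∈ A ⊎ InSAi 1 v ⊎ InSAi 2 v → f v ≡ v) ×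
          (∀ v → InSAi 3 v ⊎ v ∈ Z → Adj v (f v)) ×
          (∀ v → InSAi 3 v → Card (λ y → Adj (f v) y × InN y) 2)

{-# OPTIONS --safe #-}
module Submission where

-- The set Â = A ∪ S^A ∪ Z is independent and dominating (maximality of A in H puts every vertex
-- of N without a neighbour in A into A), so i ≤ |Â|.  Charge each vertex of N ∪ S^A_1 ∪ S^A_2 to
-- a vertex of S: a vertex of N to an S-neighbour, a vertex of S^A of degree ≤ 2 to itself.  Each
-- s ∈ S is charged at most 3 times, so injectivity of f gives
--   3|S| ≤ 3ρ = i ≤ |Â| = |f(Â)| ≤ Σ_{s ∈ S} (deg s + [s ∈ S^A, deg s ≤ 2]) ≤ 3|S|.
-- Equality throughout forces every s ∈ S to have degree 3, or degree 2 and no neighbour in A,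
-- which is (a); it also makes f onto N ∪ S^A_2, which is (b).  For (c): H has maximum degree 2,
-- so the component of a vertex x of H-degree 1 is a path starting at x, and by (i) this path
-- cannot have two or more edges when x ∉ A.

open import Defs hiding (sym)
open import Data.Nat using (ℕ; zero; suc; pred; _+_; _*_; _≤_; _<_; z≤n; s≤s; s≤s⁻¹; _≤?_)
open import Data.Nat.Properties
open import Data.Fin using (Fin; zero; suc; toℕ; fromℕ<)
import Data.Fin.Properties as Finₚ
open import Data.Fin.Subset using (Subset; _∈_; _∉_; ∣_∣; _∪_; ⁅_⁆; inside; outside)
open import Data.Fin.Subset.Properties
  using (_∈?_; ⊆-antisym; x∈⁅x⁆; x∈⁅y⁆⇒x≡y; p⊆p∪q; q⊆p∪q; x∈p∪q⁻)
open import Data.Bool using (Bool; true; false)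
import Data.Bool as Bool
open import Data.Bool.Properties using (¬-not)
open import Data.Vec using ([]; _∷_; tabulate)
import Data.Vec as Vec
open import Data.Vec.Properties using ([]=⇒lookup; lookup⇒[]=; lookup∘tabulate)
open import Data.List using (List; []; _∷_; length; map; _++_; concatMap)
open import Data.List.Properties using (length-map; length-++; length-removeAt′)
open import Data.List.Membership.Propositional using () renaming (_∈_ to _∈ₗ_)
open import Data.List.Membership.Propositional.Properties using (∈-map⁺; ∈-map⁻; ∈-concatMap⁺)
open import Data.List.Relation.Binary.Subset.Propositional using () renaming (_⊆_ to _⊆ₗ_)
open import Data.List.Relation.Unary.Any as Any using (here; there; _─_; index; any?)
open import Data.List.Relation.Unary.All as All using (All; []; _∷_)
open import Data.List.Relation.Unary.All.Properties using (¬Any⇒All¬)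
import Data.List.Relation.Unary.All.Properties as Allₚ
open import Data.List.Relation.Unary.Unique.Propositional using (Unique; []; _∷_)
import Data.List.Relation.Unary.Unique.Propositional.Properties as Uniqueₚ
open import Data.Product using (∃-syntax; _×_; _,_; proj₁; proj₂)
open import Data.Sum using (_⊎_; inj₁; inj₂; swap; map₂)
open import Function using (_∘_; case_of_)
open import Function.Bundles using (_⇔_; mk⇔; Equivalence)
open import Relation.Nullary using (¬_; yes; no; does; contradiction)
open import Relation.Nullary.Decidable using (_×-dec_; _⊎-dec_; _→-dec_; ¬?; decidable-stable)
open import Relation.Unary using (Decidable)
open import Relation.Binary.Definitions using (DecidableEquality)
open import Relation.Binary.PropositionalEquality
  using (_≡_; _≢_; refl; sym; trans; cong; subst; subst₂)

open Equivalence using (to; from)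

module _ {a} {A : Set a} where

  ∈-─ : ∀ {x z : A} {ys} (x∈ys : x ∈ₗ ys) → z ∈ₗ ys → z ≢ x → z ∈ₗ (ys ─ x∈ys)
  ∈-─ (here refl) (here refl) z≢x = contradiction refl z≢x
  ∈-─ (here refl) (there z∈ys) _  = z∈ys
  ∈-─ (there _)   (here refl)  _  = here refl
  ∈-─ (there x∈ys) (there z∈ys) z≢x = there (∈-─ x∈ys z∈ys z≢x)

  unique⊆⇒length≤ : ∀ {xs ys : List A} → Unique xs → xs ⊆ₗ ys → length xs ≤ length ys
  unique⊆⇒length≤ {[]} _ _ = z≤n
  unique⊆⇒length≤ {x ∷ xs} {ys} (x∉xs ∷ xs!) xs⊆ys = begin
    suc (length xs)          ≤⟨ s≤s (unique⊆⇒length≤ xs! xs⊆ys─x) ⟩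
    suc (length (ys ─ x∈ys)) ≡⟨ sym (length-removeAt′ ys (index x∈ys)) ⟩
    length ys                ∎
    where
    open ≤-Reasoning
    x∈ys : x ∈ₗ ys
    x∈ys = xs⊆ys (here refl)
    xs⊆ys─x : xs ⊆ₗ (ys ─ x∈ys)
    xs⊆ys─x z∈xs = ∈-─ x∈ys (xs⊆ys (there z∈xs)) (All.lookup x∉xs z∈xs ∘ sym)

  unique⊆∧length≥⇒⊇ : DecidableEquality A → ∀ {xs ys : List A} → Unique xs → xs ⊆ₗ ys →
                      length ys ≤ length xs → ys ⊆ₗ xs
  unique⊆∧length≥⇒⊇ _≟_ {xs} {ys} xs! xs⊆ys |ys|≤|xs| {y} y∈ys with any? (y ≟_) xs
  ... | yes y∈xs = y∈xs
  ... | no  y∉xs = contradiction (≤-trans longer |ys|≤|xs|) 1+n≰n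
    where
    y∷xs⊆ys : y ∷ xs ⊆ₗ ys
    y∷xs⊆ys (here refl)  = y∈ys
    y∷xs⊆ys (there z∈xs) = xs⊆ys z∈xs
    longer : suc (length xs) ≤ length ys
    longer = unique⊆⇒length≤ (¬Any⇒All¬ xs y∉xs ∷ xs!) y∷xs⊆ys

  unique-map⁺ : ∀ {b} {B : Set b} (f : A → B) {xs} →
                (∀ {u v} → u ∈ₗ xs → v ∈ₗ xs → f u ≡ f v → u ≡ v) →
                Unique xs → Unique (map f xs)
  unique-map⁺ f _ [] = []
  unique-map⁺ f f-inj (x∉xs ∷ xs!) =
    Allₚ.map⁺ (All.tabulate λ z∈xs fx≡fz →
      All.lookup x∉xs z∈xs (f-inj (here refl) (there z∈xs) fx≡fz))
    ∷ unique-map⁺ f (λ u∈ v∈ → f-inj (there u∈) (there v∈)) xs!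

module _ {a b} {A : Set a} {B : Set b} (g : A → List B) {c : ℕ} (g≤c : ∀ x → length (g x) ≤ c) where

  length-concatMap≤ : ∀ xs → length (concatMap g xs) ≤ length xs * c
  length-concatMap≤ []       = z≤n
  length-concatMap≤ (x ∷ xs) = begin
    length (g x ++ concatMap g xs)         ≡⟨ length-++ (g x) ⟩
    length (g x) + length (concatMap g xs) ≤⟨ +-mono-≤ (g≤c x) (length-concatMap≤ xs) ⟩
    c + length xs * c                      ∎
    where open ≤-Reasoning

  length-concatMap-tight : ∀ xs → length xs * c ≤ length (concatMap g xs) →
                           All (λ x → c ≤ length (g x)) xs
  length-concatMap-tight []       _     = []
  length-concatMap-tight (x ∷ xs) tight = c≤|gx| ∷ length-concatMap-tight xs rest
    where
    tight′ : c + length xs * c ≤ length (g x) + length (concatMap g xs)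
    tight′ = subst (c + length xs * c ≤_) (length-++ (g x)) tight
    c≤|gx| : c ≤ length (g x)
    c≤|gx| = +-cancelʳ-≤ _ c _
      (≤-trans tight′ (+-monoʳ-≤ (length (g x)) (length-concatMap≤ xs)))
    rest : length xs * c ≤ length (concatMap g xs)
    rest = +-cancelˡ-≤ c _ _ (≤-trans tight′ (+-monoˡ-≤ _ (g≤c x)))

toList : ∀ {n} → Subset n → List (Fin n)
toList []            = []
toList (inside ∷ p)  = zero ∷ map suc (toList p)
toList (outside ∷ p) = map suc (toList p)

length-toList : ∀ {n} (p : Subset n) → length (toList p) ≡ ∣ p ∣
length-toList []            = refl
length-toList (inside ∷ p)  = cong suc (trans (length-map suc (toList p)) (length-toList p))
length-toList (outside ∷ p) = trans (length-map suc (toList p)) (length-toList p)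

toList-unique : ∀ {n} (p : Subset n) → Unique (toList p)
toList-unique []            = []
toList-unique (inside ∷ p)  =
  Allₚ.map⁺ (All.universal (λ _ ()) (toList p)) ∷ Uniqueₚ.map⁺ Finₚ.suc-injective (toList-unique p)
toList-unique (outside ∷ p) = Uniqueₚ.map⁺ Finₚ.suc-injective (toList-unique p)

∈-toList⁺ : ∀ {n} {p : Subset n} {x} → x ∈ p → x ∈ₗ toList p
∈-toList⁺ {p = inside ∷ p}  Vec.here        = here refl
∈-toList⁺ {p = inside ∷ p}  (Vec.there x∈p) = there (∈-map⁺ suc (∈-toList⁺ x∈p))
∈-toList⁺ {p = outside ∷ p} (Vec.there x∈p) = ∈-map⁺ suc (∈-toList⁺ x∈p)

∈-toList⁻ : ∀ {n} {p : Subset n} {x} → x ∈ₗ toList p → x ∈ p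
∈-toList⁻ {p = inside ∷ p} (here refl) = Vec.here
∈-toList⁻ {p = inside ∷ p} (there x∈)
  with _ , y∈ , refl ← ∈-map⁻ suc x∈ = Vec.there (∈-toList⁻ y∈)
∈-toList⁻ {p = outside ∷ p} x∈
  with _ , y∈ , refl ← ∈-map⁻ suc x∈ = Vec.there (∈-toList⁻ y∈)

module _ {n : ℕ} where

  ∈-tabulate⇔ : ∀ (b : Fin n → Bool) {x} → x ∈ tabulate b ⇔ b x ≡ true
  ∈-tabulate⇔ b {x} = mk⇔
    (λ x∈ → trans (sym (lookup∘tabulate b x)) ([]=⇒lookup x∈))
    (λ bx → lookup⇒[]= x (tabulate b) (trans (lookup∘tabulate b x) bx))

  ⟦_⟧ : {P : Fin n → Set} → Decidable P → Subset n
  ⟦ P? ⟧ = tabulate (does ∘ P?)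

  ∈⟦⟧⇔ : ∀ {P : Fin n → Set} (P? : Decidable P) {x} → x ∈ ⟦ P? ⟧ ⇔ P x
  ∈⟦⟧⇔ P? {x} with P? x | ∈-tabulate⇔ (does ∘ P?) {x}
  ... | yes px | x∈⇔ = mk⇔ (λ _ → px) (λ _ → from x∈⇔ refl)
  ... | no ¬px | x∈⇔ = mk⇔ (λ x∈ → case to x∈⇔ x∈ of λ ()) (λ px → contradiction px ¬px)

  module _ {P : Fin n → Set} where

    Card-unique : ∀ {k m} → Card P k → Card P m → k ≡ m
    Card-unique (D , D⇔P , refl) (E , E⇔P , refl) =
      cong ∣_∣ (⊆-antisym (λ {x} → from (E⇔P x) ∘ to (D⇔P x)) (λ {x} → from (D⇔P x) ∘ to (E⇔P x)))

    Card-≥ : ∀ {k xs} → Card P k → Unique xs → (∀ {y} → y ∈ₗ xs → P y) → length xs ≤ k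
    Card-≥ (D , D⇔P , refl) xs! xs⊆P =
      ≤-trans (unique⊆⇒length≤ xs! (λ {y} y∈ → ∈-toList⁺ (from (D⇔P y) (xs⊆P y∈))))
              (≤-reflexive (length-toList D))

    Card-one : Card P 1 → ∃[ y ] (P y × ∀ {w} → P w → w ≡ y)
    Card-one card@(D , D⇔P , ∣D∣≡1) = witness (toList D) ∈-toList⁻ (trans (length-toList D) ∣D∣≡1)
      where
      only : ∀ {y w} → P y → P w → w ≡ y
      only {y} {w} py pw with w Finₚ.≟ y
      ... | yes w≡y = w≡y
      ... | no  w≢y = contradiction (Card-≥ card ((w≢y ∷ []) ∷ [] ∷ []) pair) 1+n≰n
        where
        pair : ∀ {z} → z ∈ₗ w ∷ y ∷ [] → P z
        pair (here refl)         = pw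
        pair (there (here refl)) = py
      witness : ∀ xs → (∀ {y} → y ∈ₗ xs → y ∈ D) → length xs ≡ 1 →
                ∃[ y ] (P y × ∀ {w} → P w → w ≡ y)
      witness (y ∷ _) xs⊆D _ = let py = to (D⇔P y) (xs⊆D (here refl)) in y , py , only py

-- Degrees in G and in H

module _ {n : ℕ} (G : Graph n) where

  Adj-sym : ∀ {u v} → Adj G u v → Adj G v u
  Adj-sym {u} {v} = trans (Graph.sym G v u)

  Adj-irrefl : ∀ {v} → ¬ Adj G v v
  Adj-irrefl {v} vv = case trans (sym vv) (irrefl G v) of λ ()

  neighbours : Fin n → List (Fin n)
  neighbours v = toList (tabulate (adj G v))

  ∈-neighbours⁺ : ∀ {v w} → Adj G v w → w ∈ₗ neighbours v
  ∈-neighbours⁺ {v} vw = ∈-toList⁺ (from (∈-tabulate⇔ (adj G v)) vw)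

  degree : Fin n → ℕ
  degree v = length (neighbours v)

  Deg-degree : ∀ v → Deg G v (degree v)
  Deg-degree v =
    tabulate (adj G v) , (λ _ → ∈-tabulate⇔ (adj G v)) , sym (length-toList (tabulate (adj G v)))

  Deg⇒degree≡ : ∀ {v k} → Deg G v k → degree v ≡ k
  Deg⇒degree≡ {v} = Card-unique (Deg-degree v)

  degree≤3 : Subcubic G → ∀ v → degree v ≤ 3
  degree≤3 subcubic v = subcubic v (degree v) (Deg-degree v)

  module _ (S : Subset n) where

    AdjH-sym : ∀ {u v} → AdjH G S u v → AdjH G S v u
    AdjH-sym (uN , vN , uv) = vN , uN , Adj-sym uv

    AdjH-irrefl : ∀ {v} → ¬ AdjH G S v v
    AdjH-irrefl (_ , _ , vv) = Adj-irrefl vv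

    InN? : Decidable (InN G S)
    InN? v = Finₚ.any? λ s → (s ∈? S) ×-dec (adj G s v Bool.≟ true)

    AdjH? : ∀ u → Decidable (AdjH G S u)
    AdjH? u v = InN? u ×-dec InN? v ×-dec (adj G u v Bool.≟ true)

    packing⇒∉N : Packing G S → ∀ {s} → s ∈ S → ¬ InN G S s
    packing⇒∉N packing {s} s∈S (t , t∈S , ts) with t Finₚ.≟ s
    ... | yes refl = Adj-irrefl ts
    ... | no  t≢s  = proj₁ (packing t s t∈S s∈S t≢s) ts

    H-degree≤2 : Subcubic G → Packing G S →
                 ∀ {u a b c} → AdjH G S u a → AdjH G S u b → a ≢ b → AdjH G S u c → c ≡ a ⊎ c ≡ b
    H-degree≤2 subcubic packing {u} {a} {b} {c}
               ((s , s∈S , su) , aN , ua) (_ , bN , ub) a≢b (_ , cN , uc)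
      with c Finₚ.≟ a | c Finₚ.≟ b
    ... | yes c≡a | _       = inj₁ c≡a
    ... | no  _   | yes c≡b = inj₂ c≡b
    ... | no  c≢a | no  c≢b = contradiction (≤-trans four (degree≤3 subcubic u)) (<-irrefl refl)
      where
      s∉N : ∀ {v} → InN G S v → s ≢ v
      s∉N vN refl = packing⇒∉N packing s∈S vN
      distinct : Unique (s ∷ a ∷ b ∷ c ∷ [])
      distinct = (s∉N aN ∷ s∉N bN ∷ s∉N cN ∷ [])
               ∷ (a≢b ∷ (c≢a ∘ sym) ∷ [])
               ∷ ((c≢b ∘ sym) ∷ [])
               ∷ [] ∷ []
      adjacent : ∀ {v} → v ∈ₗ s ∷ a ∷ b ∷ c ∷ [] → Adj G u v
      adjacent (here refl)                         = Adj-sym su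
      adjacent (there (here refl))                 = ua
      adjacent (there (there (here refl)))         = ub
      adjacent (there (there (there (here refl)))) = uc
      four : 4 ≤ degree u
      four = Card-≥ (Deg-degree u) distinct adjacent

-- The component of H at a vertex of H-degree one

module LeafComponent {n : ℕ} (G : Graph n) (S : Subset n)
  (max-degree-2 : ∀ {u a b c} → AdjH G S u a → AdjH G S u b → a ≢ b → AdjH G S u c → c ≡ a ⊎ c ≡ b)
  {x y : Fin n} (xy : AdjH G S x y) (only-y : ∀ {w} → AdjH G S x w → w ≡ y) where

  private
    E : Fin n → Fin n → Set
    E = AdjH G S

  Consecutive : ℕ → ℕ → Set
  Consecutive i j = i ≡ suc j ⊎ j ≡ suc i

  -- The path x = p 0, p 1, …, p k in H; the values of p beyond k are irrelevant.
  record Path (k : ℕ) (p : ℕ → Fin n) : Set where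
    field
      nontrivial  : 1 ≤ k
      start       : p 0 ≡ x
      injective   : ∀ {i j} → i ≤ k → j ≤ k → p i ≡ p j → i ≡ j
      consecutive : ∀ {i} → i < k → E (p i) (p (suc i))

  Closed : ℕ → (ℕ → Fin n) → Set
  Closed k p = ∀ {w} → E (p k) w → w ≡ p (pred k)

  last-edge : ∀ {k p} → Path k p → E (p (pred k)) (p k)
  last-edge {suc k} P = Path.consecutive P ≤-refl

  module _ {k : ℕ} {p : ℕ → Fin n} (P : Path k p) where
    open Path P

    skip-distinct : ∀ {i} → suc i < k → p i ≢ p (suc (suc i))
    skip-distinct {i} i+1<k eq = case injective (≤-trans (n≤1+n i) (<⇒≤ i+1<k)) i+1<k eq of λ ()

    -- x has only one H-neighbour, and the other interior vertices already have two on the path.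
    interior-neighbour : ∀ {i w} → i < k → E (p i) w → ∃[ j ] (j ≤ k × p j ≡ w × Consecutive i j)
    interior-neighbour {zero} {w} 0<k e =
      1 , 0<k , trans (only-y (from-x (consecutive 0<k))) (sym (only-y (from-x e))) , inj₂ refl
      where
      from-x : ∀ {v} → E (p 0) v → E x v
      from-x = subst (λ u → E u _) start
    interior-neighbour {suc i} i<k e
      with max-degree-2 (AdjH-sym G S (consecutive (<⇒≤ i<k))) (consecutive i<k) (skip-distinct i<k) e
    ... | inj₁ w≡ = i , ≤-trans (n≤1+n i) (<⇒≤ i<k) , sym w≡ , inj₁ refl
    ... | inj₂ w≡ = suc (suc i) , i<k , sym w≡ , inj₂ refl

    edge⇒consecutive : ∀ {i j} → i ≤ k → j ≤ k → E (p i) (p j) → Consecutive i j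
    edge⇒consecutive i≤k j≤k e with m≤n⇒m<n∨m≡n i≤k | m≤n⇒m<n∨m≡n j≤k
    ... | inj₁ i<k | _ with interior-neighbour i<k e
    ...   | j′ , j′≤k , pj′≡pj , cons with refl ← injective j′≤k j≤k pj′≡pj = cons
    edge⇒consecutive i≤k j≤k e | inj₂ refl | inj₁ j<k with interior-neighbour j<k (AdjH-sym G S e)
    ...   | i′ , i′≤k , pi′≡pi , cons with refl ← injective i′≤k i≤k pi′≡pi = swap cons
    edge⇒consecutive i≤k j≤k e | inj₂ refl | inj₂ refl = contradiction e (AdjH-irrefl G S)

    consecutive⇒edge : ∀ {i j} → i ≤ k → j ≤ k → Consecutive i j → E (p i) (p j)
    consecutive⇒edge i≤k _ (inj₁ refl) = AdjH-sym G S (consecutive i≤k)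
    consecutive⇒edge _ j≤k (inj₂ refl) = consecutive j≤k

    vertex-in-N : ∀ {i} → i ≤ k → InN G S (p i)
    vertex-in-N i≤k with m≤n⇒m<n∨m≡n i≤k
    ... | inj₁ i<k  = proj₁ (consecutive i<k)
    ... | inj₂ refl = proj₁ (proj₂ (last-edge P))

    end-neighbour-fresh : ∀ {w} → E (p k) w → w ≢ p (pred k) → ∀ {j} → j ≤ k → p j ≢ w
    end-neighbour-fresh e w≢ j≤k refl with m≤n⇒m<n∨m≡n j≤k
    ... | inj₂ refl = AdjH-irrefl G S e
    ... | inj₁ j<k with interior-neighbour j<k (AdjH-sym G S e)
    ...   | k′ , k′≤k , pk′≡pk , cons with refl ← injective k′≤k ≤-refl pk′≡pk with cons
    ...     | inj₁ refl = contradiction j<k (<-asym (n<1+n _))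
    ...     | inj₂ refl = w≢ refl

    module _ (closed : Closed k p) where

      closed-neighbour : ∀ {j w} → j ≤ k → E (p j) w → ∃[ i ] (i ≤ k × p i ≡ w)
      closed-neighbour j≤k e with m≤n⇒m<n∨m≡n j≤k
      ... | inj₁ j<k  = let i , i≤k , pi≡w , _ = interior-neighbour j<k e in i , i≤k , pi≡w
      ... | inj₂ refl = pred k , pred[n]≤n , sym (closed e)

      reach-stays : ∀ {u z} → ReachH G S u z → ∀ {j} → j ≤ k → p j ≡ u → ∃[ i ] (i ≤ k × p i ≡ z)
      reach-stays here         j≤k pj≡u = _ , j≤k , pj≡u
      reach-stays (step e r) j≤k refl with closed-neighbour j≤k e
      ... | i , i≤k , refl = reach-stays r i≤k refl

      toComponent : PathComponent G S x (p k) k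
      toComponent = record
        { vs       = p ∘ toℕ
        ; distinct = λ i j eq → Finₚ.toℕ-injective (injective (bound i) (bound j) eq)
        ; inN      = vertex-in-N ∘ bound
        ; start    = start
        ; end      = cong p (Finₚ.toℕ-fromℕ k)
        ; edges    = λ i j → mk⇔ (edge⇒consecutive (bound i) (bound j))
                                 (consecutive⇒edge (bound i) (bound j))
        ; covers   = covers
        }
        where
        bound : (i : Fin (suc k)) → toℕ i ≤ k
        bound = Finₚ.toℕ≤pred[n]
        covers : ∀ z → ReachH G S x z → ∃[ i ] (p (toℕ i) ≡ z)
        covers z r with i , i≤k , pi≡z ← reach-stays r z≤n start =
          fromℕ< (s≤s i≤k) , trans (cong p (Finₚ.toℕ-fromℕ< (s≤s i≤k))) pi≡z

  extend : (ℕ → Fin n) → ℕ → Fin n → ℕ → Fin n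
  extend p k w i with i ≤? k
  ... | yes _ = p i
  ... | no  _ = w

  extend-old : ∀ {p k w i} → i ≤ k → extend p k w i ≡ p i
  extend-old {k = k} {i = i} i≤k with i ≤? k
  ... | yes _   = refl
  ... | no  i≰k = contradiction i≤k i≰k

  extend-new : ∀ {p k w} → extend p k w (suc k) ≡ w
  extend-new {k = k} with suc k ≤? k
  ... | yes 1+k≤k = contradiction 1+k≤k 1+n≰n
  ... | no  _     = refl

  extend-path : ∀ {k p w} → Path k p → E (p k) w → w ≢ p (pred k) → Path (suc k) (extend p k w)
  extend-path {k} {p} {w} P e w≢ = record
    { nontrivial  = m≤n⇒m≤1+n nontrivial
    ; start       = trans (old z≤n) start
    ; injective   = injective′
    ; consecutive = consecutive′
    }
    where
    open Path P
    q = extend p k w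
    old : ∀ {i} → i ≤ k → q i ≡ p i
    old = extend-old {p} {k} {w}
    new : q (suc k) ≡ w
    new = extend-new {p} {k} {w}
    fresh : ∀ {j} → j ≤ k → q j ≢ w
    fresh j≤k = end-neighbour-fresh P e w≢ j≤k ∘ trans (sym (old j≤k))
    injective′ : ∀ {i j} → i ≤ suc k → j ≤ suc k → q i ≡ q j → i ≡ j
    injective′ i≤ j≤ qi≡qj with m≤n⇒m<n∨m≡n i≤ | m≤n⇒m<n∨m≡n j≤
    ... | inj₁ i< | inj₁ j< =
      injective (s≤s⁻¹ i<) (s≤s⁻¹ j<) (trans (sym (old (s≤s⁻¹ i<))) (trans qi≡qj (old (s≤s⁻¹ j<))))
    ... | inj₁ i< | inj₂ refl = contradiction (trans qi≡qj new) (fresh (s≤s⁻¹ i<))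
    ... | inj₂ refl | inj₁ j< = contradiction (trans (sym qi≡qj) new) (fresh (s≤s⁻¹ j<))
    ... | inj₂ refl | inj₂ refl = refl
    consecutive′ : ∀ {i} → i < suc k → E (q i) (q (suc i))
    consecutive′ i<1+k with m<1+n⇒m<n∨m≡n i<1+k
    ... | inj₁ i<k  = subst₂ E (sym (old (<⇒≤ i<k))) (sym (old i<k)) (consecutive i<k)
    ... | inj₂ refl = subst₂ E (sym (old ≤-refl)) (sym new) e

  MaximalPath : Set
  MaximalPath = ∃[ k ] ∃[ p ] (Path k p × Closed k p)

  -- A path has k + 1 distinct vertices, so it can be prolonged fewer than n times.
  grow : ∀ fuel {k p} → Path k p → n ≤ k + fuel → MaximalPath
  grow zero {k} {p} P n≤k+0
    with i , j , i<j , pi≡pj ←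
         Finₚ.pigeonhole (s≤s (subst (n ≤_) (+-identityʳ k) n≤k+0)) (p ∘ toℕ) =
    contradiction (Path.injective P (bound i) (bound j) pi≡pj) (<⇒≢ i<j)
    where
    bound : (i : Fin (suc k)) → toℕ i ≤ k
    bound = Finₚ.toℕ≤pred[n]
  grow (suc fuel) {k} {p} P n≤k+1+fuel
    with Finₚ.any? (λ w → AdjH? G S (p k) w ×-dec ¬? (w Finₚ.≟ p (pred k)))
  ... | yes (w , e , w≢) = grow fuel (extend-path P e w≢) (subst (n ≤_) (+-suc k fuel) n≤k+1+fuel)
  ... | no  ¬more        = k , p , P , λ {w} e →
    decidable-stable (w Finₚ.≟ p (pred k)) (λ w≢ → ¬more (w , e , w≢))

  edge : ℕ → Fin n
  edge zero    = x
  edge (suc _) = y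

  edge-path : Path 1 edge
  edge-path = record
    { nontrivial  = ≤-refl
    ; start       = refl
    ; injective   = injective
    ; consecutive = λ { {zero} _ → xy ; {suc _} (s≤s ()) }
    }
    where
    injective : ∀ {i j} → i ≤ 1 → j ≤ 1 → edge i ≡ edge j → i ≡ j
    injective {zero}  {zero}  _ _ _   = refl
    injective {suc zero} {suc zero} _ _ _ = refl
    injective {zero}  {suc zero} _ _ x≡y = contradiction (subst (E x) (sym x≡y) xy) (AdjH-irrefl G S)
    injective {suc zero} {zero}  _ _ y≡x = contradiction (subst (E x) y≡x xy) (AdjH-irrefl G S)
    injective {suc (suc _)} (s≤s ())
    injective {_} {suc (suc _)} _ (s≤s ())

  leaf-component : ∃[ k ] ∃[ z ] (1 ≤ k × PathComponent G S x z k)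
  leaf-component with k , p , P , closed ← grow n edge-path (n≤1+n n) =
    k , p k , Path.nontrivial P , toComponent P closed

leaf∉A⇒W : ∀ {n} (G : Graph n) (S : Subset n) → Subcubic G → Packing G S →
           ∀ {A x} → CondI G S A → x ∉ A → DegH G S x 1 → InW G S x
leaf∉A⇒W G S subcubic packing condI x∉A d₁
  with _ , xy , only-y ← Card-one d₁
  with LeafComponent.leaf-component G S (H-degree≤2 G S subcubic packing) xy only-y
... | suc zero    , z , _ , C = z , C
... | suc (suc k) , z , _ , C =
  contradiction (proj₁ (condI _ z (suc (suc k)) (s≤s (s≤s z≤n)) C)) x∉A

-- The set Â and the counting argument

module _ {n : ℕ} (G : Graph n) (S : Subset n) where

  A-saturated : ∀ {A v} → CondII G S A → InN G S v → (∀ a → a ∈ A → ¬ Adj G v a) → v ∈ A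
  A-saturated {A} {v} (condI , (A⊆N , A-indep) , A-maximal) vN v-free =
    A-maximal (A ∪ ⁅ v ⁆) (A+v⊆N , A+v-indep) A+v-condI (p⊆p∪q ⁅ v ⁆) (q⊆p∪q A ⁅ v ⁆ (x∈⁅x⁆ v))
    where
    split : ∀ {w} → w ∈ A ∪ ⁅ v ⁆ → w ∈ A ⊎ w ≡ v
    split w∈ with x∈p∪q⁻ A ⁅ v ⁆ w∈
    ... | inj₁ w∈A = inj₁ w∈A
    ... | inj₂ w∈v = inj₂ (x∈⁅y⁆⇒x≡y v w∈v)
    A+v⊆N : ∀ w → w ∈ A ∪ ⁅ v ⁆ → InN G S w
    A+v⊆N w w∈ with split w∈
    ... | inj₁ w∈A = A⊆N w w∈A
    ... | inj₂ refl = vN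
    A+v-indep : Independent G (A ∪ ⁅ v ⁆)
    A+v-indep u w u∈ w∈ with split u∈ | split w∈
    ... | inj₁ u∈A | inj₁ w∈A = A-indep u w u∈A w∈A
    ... | inj₁ u∈A | inj₂ refl = ¬-not (v-free u u∈A ∘ Adj-sym G)
    ... | inj₂ refl | inj₁ w∈A = ¬-not (v-free w w∈A)
    ... | inj₂ refl | inj₂ refl = irrefl G v
    A+v-condI : CondI G S (A ∪ ⁅ v ⁆)
    A+v-condI x z k 2≤k C = let x∈A , z∈A = condI x z k 2≤k C in p⊆p∪q ⁅ v ⁆ x∈A , p⊆p∪q ⁅ v ⁆ z∈A

  InSA? : ∀ A → Decidable (InSA G S A)
  InSA? A v = (v ∈? S) ×-dec Finₚ.all? (λ a → (a ∈? A) →-dec ¬? (adj G v a Bool.≟ true))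

  module _ (A Z : Subset n) where

    InÂ? : Decidable (InÂ G S A Z)
    InÂ? v = (v ∈? A) ⊎-dec (InSA? A v ⊎-dec (v ∈? Z))

    Â : Subset n
    Â = ⟦ InÂ? ⟧

    module _ (packing : Packing G S) (condII : CondII G S A) (Z-idom : IndepDomT G S A Z) where

      private
        A-indep : Independent G A
        A-indep = proj₂ (proj₁ (proj₂ condII))
        Z⊆T : ∀ v → v ∈ Z → InT G S A v
        Z⊆T = proj₁ Z-idom
        Z-indep : Independent G Z
        Z-indep = proj₁ (proj₂ Z-idom)
        Z-dom : ∀ t → InT G S A t → t ∈ Z ⊎ ∃[ z ] (z ∈ Z × Adj G z t)
        Z-dom = proj₂ (proj₂ Z-idom)

      Â-independent : ∀ {u v} → InÂ G S A Z u → InÂ G S A Z v → adj G u v ≡ false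
      Â-independent {u} {v} (inj₁ u∈A) (inj₁ v∈A) = A-indep u v u∈A v∈A
      Â-independent {u} (inj₁ u∈A) (inj₂ (inj₁ (_ , v-free))) = ¬-not (v-free u u∈A ∘ Adj-sym G)
      Â-independent {u} (inj₁ u∈A) (inj₂ (inj₂ v∈Z)) = ¬-not (proj₂ (Z⊆T _ v∈Z) u u∈A ∘ Adj-sym G)
      Â-independent {v = v} (inj₂ (inj₁ (_ , u-free))) (inj₁ v∈A) = ¬-not (u-free v v∈A)
      Â-independent {u} {v} (inj₂ (inj₁ (u∈S , _))) (inj₂ (inj₁ (v∈S , _))) with u Finₚ.≟ v
      ... | yes refl = irrefl G u
      ... | no  u≢v  = ¬-not (proj₁ (packing u v u∈S v∈S u≢v))
      Â-independent {u} (inj₂ (inj₁ (u∈S , _))) (inj₂ (inj₂ v∈Z)) =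
        ¬-not λ uv → proj₂ (proj₁ (Z⊆T _ v∈Z)) (u , u∈S , uv)
      Â-independent {v = v} (inj₂ (inj₂ u∈Z)) (inj₁ v∈A) = ¬-not (proj₂ (Z⊆T _ u∈Z) v v∈A)
      Â-independent {v = v} (inj₂ (inj₂ u∈Z)) (inj₂ (inj₁ (v∈S , _))) =
        ¬-not λ uv → proj₂ (proj₁ (Z⊆T _ u∈Z)) (v , v∈S , Adj-sym G uv)
      Â-independent {u} {v} (inj₂ (inj₂ u∈Z)) (inj₂ (inj₂ v∈Z)) = Z-indep u v u∈Z v∈Z

      Â-dominates-A-free : ∀ {v} → (∀ a → a ∈ A → ¬ Adj G v a) →
                           InÂ G S A Z v ⊎ ∃[ u ] (InÂ G S A Z u × Adj G u v)
      Â-dominates-A-free {v} v-free with v ∈? S | InN? G S v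
      ... | yes v∈S | _      = inj₁ (inj₂ (inj₁ (v∈S , v-free)))
      ... | no  _   | yes vN = inj₁ (inj₁ (A-saturated condII vN v-free))
      ... | no  v∉S | no v∉N with Z-dom v ((v∉S , v∉N) , v-free)
      ...   | inj₁ v∈Z           = inj₁ (inj₂ (inj₂ v∈Z))
      ...   | inj₂ (z , z∈Z , zv) = inj₂ (z , inj₂ (inj₂ z∈Z) , zv)

      Â-dominating : ∀ v → InÂ G S A Z v ⊎ ∃[ u ] (InÂ G S A Z u × Adj G u v)
      Â-dominating v with Finₚ.any? (λ a → (a ∈? A) ×-dec (adj G a v Bool.≟ true))
      ... | yes (a , a∈A , av) = inj₂ (a , inj₁ a∈A , av)
      ... | no  ¬av            = Â-dominates-A-free λ a a∈A va → ¬av (a , a∈A , Adj-sym G va)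

      Â-indepDominating : IndepDominating G Â
      Â-indepDominating = independent , dominating
        where
        independent : Independent G Â
        independent u v u∈ v∈ = Â-independent (to (∈⟦⟧⇔ InÂ?) u∈) (to (∈⟦⟧⇔ InÂ?) v∈)
        dominating : Dominating G Â
        dominating v with Â-dominating v
        ... | inj₁ v̂            = inj₁ (from (∈⟦⟧⇔ InÂ?) v̂)
        ... | inj₂ (u , û , uv) = inj₂ (u , from (∈⟦⟧⇔ InÂ?) û , uv)

module Counting {n : ℕ} (G : Graph n) (subcubic : Subcubic G) (S : Subset n) (packing : Packing G S)
  (A : Subset n) (condII : CondII G S A) (Z : Subset n) (Z-idom : IndepDomT G S A Z)
  (f : Fin n → Fin n)
  (f-into : ∀ v → InÂ G S A Z v → InN G S (f v) ⊎ InSAi G S A 1 (f v) ⊎ InSAi G S A 2 (f v))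
  (f-injective : ∀ u v → InÂ G S A Z u → InÂ G S A Z v → f u ≡ f v → u ≡ v)
  {i ρ : ℕ} (i-min : ∀ D → IndepDominating G D → i ≤ ∣ D ∣) (ρ-max : ∀ D → Packing G D → ∣ D ∣ ≤ ρ)
  (i≡3ρ : i ≡ 3 * ρ) where

  InSA≤2 : Fin n → Set
  InSA≤2 s = InSA G S A s × degree G s ≤ 2

  InSA≤2? : Decidable InSA≤2
  InSA≤2? s = InSA? G S A s ×-dec (degree G s ≤? 2)

  targets : Fin n → List (Fin n)
  targets s with InSA≤2? s
  ... | yes _ = s ∷ neighbours G s
  ... | no  _ = neighbours G s

  targets≤3 : ∀ s → length (targets s) ≤ 3
  targets≤3 s with InSA≤2? s
  ... | yes (_ , d≤2) = s≤s d≤2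
  ... | no  _         = degree≤3 G subcubic s

  targets-full : ∀ s → 3 ≤ length (targets s) → degree G s ≡ 3 ⊎ (degree G s ≡ 2 × InSA G S A s)
  targets-full s full with InSA≤2? s
  ... | yes (sA , d≤2) = inj₂ (≤-antisym d≤2 (s≤s⁻¹ full) , sA)
  ... | no  _          = inj₁ (≤-antisym (degree≤3 G subcubic s) full)

  neighbour∈targets : ∀ {s y} → Adj G s y → y ∈ₗ targets s
  neighbour∈targets {s} sy with InSA≤2? s
  ... | yes _ = there (∈-neighbours⁺ G sy)
  ... | no  _ = ∈-neighbours⁺ G sy

  InSA≤2⇒∈targets : ∀ {s} → InSA≤2 s → s ∈ₗ targets s
  InSA≤2⇒∈targets {s} sA≤2 with InSA≤2? s
  ... | yes _       = here refl
  ... | no  ¬sA≤2 = contradiction sA≤2 ¬sA≤2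

  all-targets : List (Fin n)
  all-targets = concatMap targets (toList S)

  ∈-all-targets : ∀ {s y} → s ∈ S → y ∈ₗ targets s → y ∈ₗ all-targets
  ∈-all-targets s∈S y∈ = ∈-concatMap⁺ targets (Any.map (λ { refl → y∈ }) (∈-toList⁺ s∈S))

  codomain⊆all-targets : ∀ {y} → InN G S y ⊎ InSAi G S A 1 y ⊎ InSAi G S A 2 y → y ∈ₗ all-targets
  codomain⊆all-targets (inj₁ (s , s∈S , sy)) = ∈-all-targets s∈S (neighbour∈targets sy)
  codomain⊆all-targets (inj₂ (inj₁ (yA@(y∈S , _) , d₁))) =
    ∈-all-targets y∈S (InSA≤2⇒∈targets (yA , ≤-trans (≤-reflexive (Deg⇒degree≡ G d₁)) (n≤1+n 1)))
  codomain⊆all-targets (inj₂ (inj₂ (yA@(y∈S , _) , d₂))) =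
    ∈-all-targets y∈S (InSA≤2⇒∈targets (yA , ≤-reflexive (Deg⇒degree≡ G d₂)))

  Âs : List (Fin n)
  Âs = toList (Â G S A Z)

  images : List (Fin n)
  images = map f Âs

  Â-sound : ∀ {v} → v ∈ₗ Âs → InÂ G S A Z v
  Â-sound = to (∈⟦⟧⇔ (InÂ? G S A Z)) ∘ ∈-toList⁻

  images-unique : Unique images
  images-unique =
    unique-map⁺ f (λ u∈ v∈ → f-injective _ _ (Â-sound u∈) (Â-sound v∈)) (toList-unique (Â G S A Z))

  images⊆all-targets : images ⊆ₗ all-targets
  images⊆all-targets y∈ with v , v∈ , refl ← ∈-map⁻ f y∈ =
    codomain⊆all-targets (f-into v (Â-sound v∈))

  3|S|≤|images| : length (toList S) * 3 ≤ length images
  3|S|≤|images| = begin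
    length (toList S) * 3  ≡⟨ cong (_* 3) (length-toList S) ⟩
    ∣ S ∣ * 3              ≡⟨ *-comm ∣ S ∣ 3 ⟩
    3 * ∣ S ∣              ≤⟨ *-monoʳ-≤ 3 (ρ-max S packing) ⟩
    3 * ρ                  ≡⟨ sym i≡3ρ ⟩
    i                      ≤⟨ i-min (Â G S A Z) (Â-indepDominating G S A Z packing condII Z-idom) ⟩
    ∣ Â G S A Z ∣          ≡⟨ sym (length-toList (Â G S A Z)) ⟩
    length Âs              ≡⟨ sym (length-map f Âs) ⟩
    length images          ∎
    where open ≤-Reasoning

  all-targets⊆images : all-targets ⊆ₗ images
  all-targets⊆images = unique⊆∧length≥⇒⊇ Finₚ._≟_ images-unique images⊆all-targets
    (≤-trans (length-concatMap≤ targets targets≤3 (toList S)) 3|S|≤|images|)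

  packed-degree : ∀ {s} → s ∈ S → degree G s ≡ 3 ⊎ (degree G s ≡ 2 × InSA G S A s)
  packed-degree s∈S = targets-full _ (All.lookup full (∈-toList⁺ s∈S))
    where
    full : All (λ s → 3 ≤ length (targets s)) (toList S)
    full = length-concatMap-tight targets targets≤3 (toList S)
      (≤-trans 3|S|≤|images| (unique⊆⇒length≤ images-unique images⊆all-targets))

  Sᵢ-degree : ∀ {k s} → InSi G S k s → k ≡ 3 ⊎ (k ≡ 2 × InSA G S A s)
  Sᵢ-degree (s∈S , dₖ) rewrite sym (Deg⇒degree≡ G dₖ) = packed-degree s∈S

  no-S₁ : ∀ s → ¬ InSi G S 1 s
  no-S₁ s s₁ with Sᵢ-degree s₁
  ... | inj₁ ()
  ... | inj₂ (() , _)

  S₂⊆Sᴬ₂ : ∀ s → InSi G S 2 s → InSAi G S A 2 s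
  S₂⊆Sᴬ₂ s s₂@(_ , d₂) with Sᵢ-degree s₂
  ... | inj₁ ()
  ... | inj₂ (_ , sA) = sA , d₂

  Â-split : ∀ v → InÂ G S A Z v → v ∈ A ⊎ InSAi G S A 2 v ⊎ InSAi G S A 3 v ⊎ v ∈ Z
  Â-split v (inj₁ v∈A)         = inj₁ v∈A
  Â-split v (inj₂ (inj₂ v∈Z))  = inj₂ (inj₂ (inj₂ v∈Z))
  Â-split v (inj₂ (inj₁ vA)) with packed-degree (proj₁ vA)
  ... | inj₁ d≡3       = inj₂ (inj₂ (inj₁ (vA , subst (Deg G v) d≡3 (Deg-degree G v))))
  ... | inj₂ (d≡2 , _) = inj₂ (inj₁ (vA , subst (Deg G v) d≡2 (Deg-degree G v)))

  f-into-N∪Sᴬ₂ : ∀ v → InÂ G S A Z v → InN G S (f v) ⊎ InSAi G S A 2 (f v)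
  f-into-N∪Sᴬ₂ v v̂ with f-into v v̂
  ... | inj₁ fvN                     = inj₁ fvN
  ... | inj₂ (inj₁ ((fv∈S , _) , d₁)) = contradiction (fv∈S , d₁) (no-S₁ (f v))
  ... | inj₂ (inj₂ fv₂)               = inj₂ fv₂

  f-onto-N∪Sᴬ₂ : ∀ y → InN G S y ⊎ InSAi G S A 2 y → ∃[ v ] (InÂ G S A Z v × f v ≡ y)
  f-onto-N∪Sᴬ₂ y y∈
    with v , v∈ , refl ← ∈-map⁻ f (all-targets⊆images (codomain⊆all-targets (map₂ inj₂ y∈))) =
    v , Â-sound v∈ , refl

lemma3 : ∀ {n} (G : Graph n) → Subcubic G → Connected G →
  (i ρ : ℕ) → IndepDomNumber G i → PackingNumber G ρ → i ≡ 3 * ρ →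
  (S : Subset n) → MaximalPacking G S →
  (A : Subset n) → CondIII G S A →
  (Z : Subset n) → IndepDomT G S A Z →
  (f : Fin n → Fin n) → GoodF G S A Z f →
  -- (a)
  ((∀ s → ¬ InSi G S 1 s) ×
   (∀ s → InSi G S 2 s → InSAi G S A 2 s) ×
   (∀ s → InSAi G S A 2 s → InSi G S 2 s)) ×
  -- (b)
  ((∀ v → InÂ G S A Z v →
      v ∈ A ⊎ InSAi G S A 2 v ⊎ InSAi G S A 3 v ⊎ v ∈ Z) ×
   (∀ v → InÂ G S A Z v → InN G S (f v) ⊎ InSAi G S A 2 (f v)) ×
   (∀ y → InN G S y ⊎ InSAi G S A 2 y →
      ∃[ v ] (InÂ G S A Z v × f v ≡ y))) ×
  -- (c)
  (∀ x → InN G S x → x ∉ A → DegH G S x 1 → InW G S x)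
lemma3 G subcubic _ _ _ (_ , i-min) (_ , ρ-max) i≡3ρ S (packing , _) A (condII , _) Z Z-idom
       f (f-into , f-injective , _) =
  (no-S₁ , S₂⊆Sᴬ₂ , λ { s ((s∈S , _) , d₂) → s∈S , d₂ }) ,
  (Â-split , f-into-N∪Sᴬ₂ , f-onto-N∪Sᴬ₂) ,
  (λ x _ x∉A d₁ → leaf∉A⇒W G S subcubic packing (proj₁ condII) x∉A d₁)
  where
  open Counting G subcubic S packing A condII Z Z-idom f f-into f-injective i-min ρ-max i≡3ρ
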